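{- Let $(s,h)$ be a memory state, $h'\sqsubseteq h$ and $q\ge1$. Then $\mathrm{Labels}_q(s,h')\subseteq\mathrm{Labels}_q(s,h)$.
   Context: A memory state is a pair $(s,h)$ with $s:\mathrm{PVAR}\to\mathrm{LOC}$ (program variables $x_1,x_2,\dots$) and $h$ a partial function $\mathrm{LOC}\to\mathrm{LOC}$ with finite domain; $h'\sqsubseteq h$ means $h'$ is the restriction of $h$ to a subset of $\mathrm{dom}(h)$. $h^0$ is the identity and $h^{n+1}(l)=h(h^n(l))$ when defined. For $i,j\in\{1,\dots,q\}$, the meet-point $[\![m_q(x_i,x_j)]\!]^q_{s,h}$ is the unique location $l$ (if it exists; otherwise it is undefined) such that: there are $L_1,L_2\ge0$ with $h^{L_1}(s(x_i))=h^{L_2}(s(x_j))=l$; for all $L_1'<L_1$ and all $L_2'\ge0$, $h^{L_1'}(s(x_i))\neq h^{L_2'}(s(x_j))$; and there are $k\in\{1,\dots,q\}$, $L\ge0$ with $h^L(l)=s(x_k)$. The set of labelled locations is $\mathrm{Labels}_q(s,h)=\{s(x_i)\mid i\in\{1,\dots,q\}\}\cup\{[\![m_q(x_i,x_j)]\!]^q_{s,h}\mid i,j\in\{1,\dots,q\},\text{ defined}\}$. -}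

module Defs where

open import Data.Nat using (ℕ; zero; suc; _≤_; _<_)
open import Data.Maybe using (Maybe; just; nothing; _>>=_)
open import Data.Product using (Σ; ∃; ∃-syntax; _×_; _,_)
open import Data.Sum using (_⊎_)
open import Relation.Binary.PropositionalEquality using (_≡_)
open import Relation.Nullary using (¬_)

LOC : Set
LOC = ℕ

-- Program variables x₁, x₂, … are indexed by ℕ (index i stands for xᵢ).
PVAR : Set
PVAR = ℕ

Store : Set
Store = PVAR → LOC

PMap : Set
PMap = LOC → Maybe LOC

FiniteDom : PMap → Set
FiniteDom h = ∃[ N ] (∀ l → N ≤ l → h l ≡ nothing)

Heap : Set
Heap = Σ PMap FiniteDom

app : Heap → PMap
app (h , _) = h

_⊑_ : Heap → Heap → Set
h' ⊑ h = ∀ l v → app h' l ≡ just v → app h l ≡ just v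

iter : Heap → ℕ → LOC → Maybe LOC
iter h zero    l = just l
iter h (suc n) l = iter h n l >>= app h

InRange : ℕ → ℕ → Set
InRange q i = 1 ≤ i × i ≤ q

-- l is the meet-point ⟦m_q(x_i,x_j)⟧^q_{s,h} (the defining conditions
-- determine l uniquely, so the partial value is given as a relation).
IsMeet : ℕ → Store → Heap → PVAR → PVAR → LOC → Set
IsMeet q s h i j l =
  (∃[ L₁ ] ∃[ L₂ ] (iter h L₁ (s i) ≡ just l × iter h L₂ (s j) ≡ just l
     × (∀ L₁' L₂' → L₁' < L₁ → ∀ a → iter h L₁' (s i) ≡ just a
          → ¬ (iter h L₂' (s j) ≡ just a))))
  × (∃[ k ] ∃[ L ] (InRange q k × iter h L l ≡ just (s k)))

Labels : ℕ → Store → Heap → LOC → Set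
Labels q s h l =
  (∃[ i ] (InRange q i × s i ≡ l))
  ⊎ (∃[ i ] ∃[ j ] (InRange q i × InRange q j × IsMeet q s h i j l))

-- If l is the meet-point of xᵢ and xⱼ in h', then the h'-paths from xᵢ and xⱼ are
-- prefixes of the h-paths and l stays a common point; only the minimality of the
-- xᵢ-prefix can fail, when the longer h-path from xⱼ runs on to a point a of that
-- prefix. Then l → a → l is a cycle, and l is the meet-point of xⱼ and xᵢ in h:
-- a point b of the xⱼ-prefix reachable from xᵢ would lie on that cycle too, and of
-- two points on a cycle through l, one lies on the other's path to l, which puts a
-- or b on both h'-paths before l. Since heaps are finite, reachability is decidable
-- (a shortest path from x visits no location twice), so the two cases can be told apart.
module Submission where

open import Defs
open import Data.Nat using (ℕ; _≤_; _<_; _+_; _∸_; suc; s≤s; _<?_; _≟_)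
open import Data.Nat.Properties
open import Data.Maybe using (just; nothing; _>>=_)
open import Data.Maybe.Properties using (≡-dec; just-injective)
open import Data.Product using (∃; ∃-syntax; _×_; _,_; proj₁; proj₂)
open import Data.Sum using (_⊎_; inj₁; inj₂)
open import Data.Fin using (Fin; toℕ; fromℕ<)
open import Data.Fin.Properties using (pigeonhole; toℕ<n; toℕ-fromℕ<)
open import Relation.Nullary using (¬_; Dec; yes; no; contradiction)
open import Relation.Unary using (Pred; Decidable)
open import Relation.Binary.PropositionalEquality

Least : Pred ℕ _ → ℕ → Set
Least P m = P m × (∀ {k} → k < m → ¬ P k)

least-below-or-none : ∀ {P : Pred ℕ _} → Decidable P → ∀ n →
  (∃[ m ] m < n × Least P m) ⊎ (∀ {k} → k < n → ¬ P k)
least-below-or-none P? 0 = inj₂ λ ()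
least-below-or-none {P} P? (suc n) with least-below-or-none P? n
... | inj₁ (m , m<n , least) = inj₁ (m , m<n⇒m<1+n m<n , least)
... | inj₂ none with P? n
...   | yes p = inj₁ (n , ≤-refl , p , none)
...   | no ¬p = inj₂ λ k<1+n → case (m≤n⇒m<n∨m≡n (≤-pred k<1+n))
  where
    case : ∀ {k} → k < n ⊎ k ≡ n → ¬ P k
    case (inj₁ k<n) = none k<n
    case (inj₂ refl) = ¬p

least : ∀ {P : Pred ℕ _} → Decidable P → ∀ {n} → P n → ∃ (Least P)
least P? {n} p with least-below-or-none P? (suc n)
... | inj₁ (m , _ , least-m) = m , least-m
... | inj₂ none = contradiction p (none ≤-refl)

bound : Heap → ℕ
bound (_ , N , _) = N

dom-bounded : ∀ h {z y} → app h z ≡ just y → z < bound h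
dom-bounded (_ , N , undefined) {z} hz with z <? N
... | yes z<N = z<N
... | no z≮N = contradiction (trans (sym hz) (undefined z (≮⇒≥ z≮N))) λ ()

Reach : Heap → LOC → LOC → Set
Reach h x y = ∃[ n ] iter h n x ≡ just y

PrefixUnreachable : Heap → LOC → ℕ → LOC → Set
PrefixUnreachable h x L₁ y =
  ∀ L₁' L₂' → L₁' < L₁ → ∀ a → iter h L₁' x ≡ just a → ¬ (iter h L₂' y ≡ just a)

FirstMeet : Heap → LOC → LOC → LOC → Set
FirstMeet h x y l =
  ∃[ L₁ ] ∃[ L₂ ] (iter h L₁ x ≡ just l × iter h L₂ y ≡ just l × PrefixUnreachable h x L₁ y)

module _ (h : Heap) where

  iter-suc⁻¹ : ∀ n {x y} → iter h (suc n) x ≡ just y →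
    ∃[ z ] iter h n x ≡ just z × app h z ≡ just y
  iter-suc⁻¹ n {x} hit with iter h n x
  ... | just z = z , refl , hit

  iter-+ : ∀ n {m x z} → iter h m x ≡ just z → iter h (n + m) x ≡ iter h n z
  iter-+ 0 hit = hit
  iter-+ (suc n) hit = cong (_>>= app h) (iter-+ n hit)

  iter-trans : ∀ n {m x y z} → iter h m x ≡ just z → iter h n z ≡ just y →
    iter h (n + m) x ≡ just y
  iter-trans n hit₁ hit₂ = trans (iter-+ n hit₁) hit₂

  iter-∸ : ∀ {m n x y z} → m ≤ n → iter h m x ≡ just z → iter h n x ≡ just y →
    iter h (n ∸ m) z ≡ just y
  iter-∸ {m} {n} {x} {y} {z} m≤n hitₘ hitₙ = begin
    iter h (n ∸ m) z     ≡⟨ iter-+ (n ∸ m) hitₘ ⟨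
    iter h (n ∸ m + m) x ≡⟨ cong (λ k → iter h k x) (m∸n+n≡m m≤n) ⟩
    iter h n x           ≡⟨ hitₙ ⟩
    just y               ∎
    where open ≡-Reasoning

  iter-prefix : ∀ {m n x y} → m ≤ n → iter h n x ≡ just y → ∃[ z ] iter h m x ≡ just z
  iter-prefix {n = n} m≤n hit with m≤n⇒m<n∨m≡n m≤n
  ... | inj₂ refl = _ , hit
  iter-prefix {n = suc n} _ hit | inj₁ (s≤s m≤n) =
    let z , hit′ , _ = iter-suc⁻¹ n hit in iter-prefix m≤n hit′

  iter-in-dom : ∀ n {x y} → iter h (suc n) x ≡ just y → ∃[ z ] iter h n x ≡ just z × z < bound h
  iter-in-dom n hit = let z , hit′ , hz = iter-suc⁻¹ n hit in z , hit′ , dom-bounded h hz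

  iter-cut-loop : ∀ {i j m x y z} → j ≤ m →
    iter h i x ≡ just z → iter h j x ≡ just z → iter h m x ≡ just y →
    iter h (m ∸ j + i) x ≡ just y
  iter-cut-loop {j = j} {m} j≤m hitᵢ hitⱼ hitₘ = iter-trans (m ∸ j) hitᵢ (iter-∸ j≤m hitⱼ hitₘ)

  path-repeats : ∀ {m x y} → bound h < m → iter h m x ≡ just y →
    ∃[ i ] ∃[ j ] ∃[ z ] i < j × j < m × iter h i x ≡ just z × iter h j x ≡ just z
  path-repeats {m} {x} N<m hit =
    toℕ i , toℕ j , visited i .proj₁ , i<j , t<m j , visited i .proj₂ .proj₁ , hitⱼ
    where
      t<m : (t : Fin (suc (bound h))) → toℕ t < m
      t<m t = ≤-<-trans (≤-pred (toℕ<n t)) N<m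
      visited : (t : Fin (suc (bound h))) → ∃[ z ] iter h (toℕ t) x ≡ just z × z < bound h
      visited t = let _ , hit′ = iter-prefix (t<m t) hit in iter-in-dom (toℕ t) hit′
      slot : Fin (suc (bound h)) → Fin (bound h)
      slot t = fromℕ< (visited t .proj₂ .proj₂)
      collision = pigeonhole ≤-refl slot
      i = collision .proj₁
      j = collision .proj₂ .proj₁
      i<j = collision .proj₂ .proj₂ .proj₁
      same-slot : visited j .proj₁ ≡ visited i .proj₁
      same-slot = trans (sym (toℕ-fromℕ< _))
                    (trans (cong toℕ (sym (collision .proj₂ .proj₂ .proj₂))) (toℕ-fromℕ< _))
      hitⱼ = trans (visited j .proj₂ .proj₁) (cong just same-slot)

  Hits : LOC → LOC → Pred ℕ _
  Hits x y n = iter h n x ≡ just y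

  hits? : ∀ x y → Decidable (Hits x y)
  hits? x y n = ≡-dec _≟_ (iter h n x) (just y)

  hitting-time-≤-bound : ∀ {m x y} → Least (Hits x y) m → m ≤ bound h
  hitting-time-≤-bound {m} (hit , earlier) with m ≤? bound h
  ... | yes m≤N = m≤N
  ... | no m≰N =
    let i , j , _ , i<j , j<m , hitᵢ , hitⱼ = path-repeats (≰⇒> m≰N) hit
        shorter = subst (m ∸ j + i <_) (m∸n+n≡m (<⇒≤ j<m)) (+-monoʳ-< (m ∸ j) i<j)
    in contradiction (iter-cut-loop (<⇒≤ j<m) hitᵢ hitⱼ hit) (earlier shorter)

  reach? : ∀ x y → Dec (Reach h x y)
  reach? x y with least-below-or-none (hits? x y) (suc (bound h))
  ... | inj₁ (n , _ , hit , _) = yes (n , hit)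
  ... | inj₂ none = no λ (n , hit) →
    let _ , least-m = least (hits? x y) {n} hit
    in none (s≤s (hitting-time-≤-bound least-m)) (proj₁ least-m)

  first-hit-after : ∀ {l a b d u r} → 0 < d → iter h d a ≡ just l → iter h u l ≡ just a →
    Least (Hits l b) r → u ≤ r → ∃[ g ] g < d × iter h g a ≡ just b
  first-hit-after {d = d} {u} {r} 0<d a↝l l↝a (l↝b , earlier) u≤r = r ∸ u , g<d , a↝b
    where
      a↝b = iter-∸ u≤r l↝a l↝b
      g<d : r ∸ u < d
      g<d with r ∸ u <? d
      ... | yes g<d = g<d
      ... | no g≮d = contradiction (iter-∸ (≮⇒≥ g≮d) a↝l a↝b)
                       (earlier (<-≤-trans (∸-monoʳ-< 0<d (≮⇒≥ g≮d)) (m∸n≤m r u)))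

  -- Whichever of a and b is reached first from l lies on the path from l to the other.
  cycle-order : ∀ {l a b d w} → 0 < d → 0 < w → iter h d a ≡ just l → iter h w b ≡ just l →
    Reach h l a → Reach h l b →
    (∃[ g ] g < d × iter h g a ≡ just b) ⊎ (∃[ e ] e < w × iter h e b ≡ just a)
  cycle-order {l} {a} {b} 0<d 0<w a↝l b↝l (u₀ , l↝a) (r₀ , l↝b)
    with u , least-u ← least (hits? l a) {u₀} l↝a
       | r , least-r ← least (hits? l b) {r₀} l↝b
    with ≤-total u r
  ... | inj₁ u≤r = inj₁ (first-hit-after 0<d a↝l (proj₁ least-u) least-r u≤r)
  ... | inj₂ r≤u = inj₂ (first-hit-after 0<w b↝l (proj₁ least-r) least-u r≤u)

module _ {h h' : Heap} (h'⊑h : h' ⊑ h) where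

  iter-⊑ : ∀ n {x y} → iter h' n x ≡ just y → iter h n x ≡ just y
  iter-⊑ 0 hit = hit
  iter-⊑ (suc n) hit =
    let z , hit′ , hz = iter-suc⁻¹ h' n hit
    in trans (cong (_>>= app h) (iter-⊑ n hit′)) (h'⊑h z _ hz)

  iter-⊑-prefix : ∀ {m n x y z} → m ≤ n → iter h' n x ≡ just y → iter h m x ≡ just z →
    iter h' m x ≡ just z
  iter-⊑-prefix {m} m≤n hit′ hit =
    let w , hit-w = iter-prefix h' m≤n hit′
    in trans hit-w (cong just (just-injective (trans (sym (iter-⊑ m hit-w)) hit)))

  reach-past : ∀ {n x l a} → iter h' n x ≡ just l → (∀ m → ¬ iter h' m x ≡ just a) →
    Reach h x a → Reach h l a
  reach-past {n} x↝l unreached (m , x↝a) with m <? n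
  ... | yes m<n = contradiction (iter-⊑-prefix (<⇒≤ m<n) x↝l x↝a) (unreached m)
  ... | no m≮n = m ∸ n , iter-∸ h (≮⇒≥ m≮n) (iter-⊑ n x↝l) x↝a

<∸⇒+< : ∀ {a m n} → a < n ∸ m → m ≤ n → a + m < n
<∸⇒+< {m = m} a<n∸m m≤n = subst (_ + m <_) (m∸n+n≡m m≤n) (+-monoˡ-< m a<n∸m)

module _ {h h' : Heap} (h'⊑h : h' ⊑ h) {x y l L₁ L₂} (x↝l : iter h' L₁ x ≡ just l)
         (y↝l : iter h' L₂ y ≡ just l) (unreachable : PrefixUnreachable h' x L₁ y) where

  prefix-unreachable-swap : ∀ {L₁' a} → L₁' < L₁ → iter h' L₁' x ≡ just a → Reach h y a →
    PrefixUnreachable h y L₂ x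
  prefix-unreachable-swap {L₁'} {a} L₁'<L₁ x↝a y↝a P Q P<L₂ b y↝b x↝b
    with Q <? L₁
  ... | yes Q<L₁ = unreachable Q P Q<L₁ b (iter-⊑-prefix h'⊑h (<⇒≤ Q<L₁) x↝l x↝b) y↝b′
    where y↝b′ = iter-⊑-prefix h'⊑h (<⇒≤ P<L₂) y↝l y↝b
  ... | no Q≮L₁
    with cycle-order h (m<n⇒0<n∸m L₁'<L₁) (m<n⇒0<n∸m P<L₂)
           (iter-∸ h (<⇒≤ L₁'<L₁) (iter-⊑ h'⊑h L₁' x↝a) (iter-⊑ h'⊑h L₁ x↝l))
           (iter-∸ h (<⇒≤ P<L₂) y↝b (iter-⊑ h'⊑h L₂ y↝l))
           (reach-past h'⊑h {L₂} y↝l (λ m → unreachable L₁' m L₁'<L₁ a x↝a) y↝a)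
           (Q ∸ L₁ , iter-∸ h (≮⇒≥ Q≮L₁) (iter-⊑ h'⊑h L₁ x↝l) x↝b)
  ... | inj₁ (g , g<d , a↝b) =
    let early = <∸⇒+< g<d (<⇒≤ L₁'<L₁)
        x↝b′ = iter-trans h g (iter-⊑ h'⊑h L₁' x↝a) a↝b
    in unreachable (g + L₁') P early b (iter-⊑-prefix h'⊑h (<⇒≤ early) x↝l x↝b′)
         (iter-⊑-prefix h'⊑h (<⇒≤ P<L₂) y↝l y↝b)
  ... | inj₂ (e , e<w , b↝a) =
    let early = <∸⇒+< e<w (<⇒≤ P<L₂)
    in unreachable L₁' (e + P) L₁'<L₁ a x↝a
         (iter-⊑-prefix h'⊑h (<⇒≤ early) y↝l (iter-trans h e y↝b b↝a))

early-reach? : (h h' : Heap) (x y : LOC) → Decidable (λ k → ∃[ a ] iter h' k x ≡ just a × Reach h y a)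
early-reach? h h' x y k with iter h' k x
... | nothing = no λ ()
... | just a with reach? h y a
...   | yes y↝a = yes (a , refl , y↝a)
...   | no y↛a = no λ { (_ , refl , y↝a) → y↛a y↝a }

firstMeet-⊑ : ∀ {h h' x y l} → h' ⊑ h → FirstMeet h' x y l → FirstMeet h x y l ⊎ FirstMeet h y x l
firstMeet-⊑ {h} {h'} {x} {y} h'⊑h (L₁ , L₂ , x↝l , y↝l , unreachable)
  with least-below-or-none (early-reach? h h' x y) L₁
... | inj₁ (L₁' , L₁'<L₁ , (a , x↝a , y↝a) , _) =
  inj₂ (L₂ , L₁ , iter-⊑ h'⊑h L₂ y↝l , iter-⊑ h'⊑h L₁ x↝l ,
        prefix-unreachable-swap h'⊑h x↝l y↝l unreachable L₁'<L₁ x↝a y↝a)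
... | inj₂ none =
  inj₁ (L₁ , L₂ , iter-⊑ h'⊑h L₁ x↝l , iter-⊑ h'⊑h L₂ y↝l ,
        λ L₁' L₂' L₁'<L₁ a x↝a y↝a →
          none L₁'<L₁ (a , iter-⊑-prefix h'⊑h (<⇒≤ L₁'<L₁) x↝l x↝a , L₂' , y↝a))

lemma4p3 : (s : Store) (h h' : Heap) (q : ℕ) → h' ⊑ h → 1 ≤ q →
    ∀ l → Labels q s h' l → Labels q s h l
lemma4p3 s h h' q h'⊑h _ l (inj₁ xᵢ≡l) = inj₁ xᵢ≡l
lemma4p3 s h h' q h'⊑h _ l (inj₂ (i , j , i∈q , j∈q , meet , k , L , k∈q , l↝xₖ))
  with firstMeet-⊑ h'⊑h meet
... | inj₁ meetᵢⱼ = inj₂ (i , j , i∈q , j∈q , meetᵢⱼ , k , L , k∈q , iter-⊑ h'⊑h L l↝xₖ)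
... | inj₂ meetⱼᵢ = inj₂ (j , i , j∈q , i∈q , meetⱼᵢ , k , L , k∈q , iter-⊑ h'⊑h L l↝xₖ)
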